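{- Let $G=(A,B,E)$ be a bipartite graph with $|A|=n$ in which every vertex of $A$ has a neighbor, and let $d=\operatorname{deg}_{\max}\mathrm{semi}(A,B,E)$. Let $A'$ be a nonempty subset of $A$ with minimal expansion, i.e. $A'\in\arg\min_{\varnothing\ne A''\subseteq A}\frac{|\Gamma(A'')|}{|A''|}$, and let $\alpha=\frac{|\Gamma(A')|}{|A'|}$. Then $d=\lceil\alpha^{ -1}\rceil$.
   Context: $\Gamma(X)$ is the set of neighbors in $G$ of vertices of $X$. $\deg_F(v)$ is the number of edges of $F$ at $v$; $\operatorname{deg}_{\max}F=\max_v\deg_F(v)$. A semi-matching is $S\subseteq E$ with $\deg_S(a)=1$ for all $a\in A$; a degree-minimizing path with respect to $S$ is a path $b_1,a_1,b_2,\dots,a_{k-1},b_k$ with $(a_i,b_i)\in S$, $(a_i,b_{i+1})\in E\setminus S$, $\deg_S(b_1)\ge\deg_S(b_k)+2$; $\mathrm{semi}(A,B,E)$ is an optimal semi-matching (none such path); all optimal semi-matchings have the same, minimum possible, maximum degree. -}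

module Defs where

open import Data.Nat using (ℕ; zero; suc; _+_; _*_; _≤_; _⊔_)
open import Data.Nat.DivMod using (_/_)
open import Data.Bool using (Bool; true; false; _∧_)
open import Data.Fin using (Fin; zero; suc; inject₁; fromℕ; _≟_)
open import Data.Fin.Subset using (Subset; ∣_∣; Nonempty)
open import Data.Vec using (tabulate; lookup)
open import Data.List using (List; allFin; foldr; map)
open import Data.Bool.ListAction using (any)
open import Data.Product using (Σ; ∃; _×_)
open import Relation.Binary.PropositionalEquality using (_≡_; _≢_)
open import Relation.Nullary using (¬_)
open import Relation.Nullary.Decidable using (⌊_⌋)
open import Function.Definitions using (Injective)

-- A bipartite graph G = (A, B, E) with A = Fin n, B = Fin m,
-- E given as a Boolean adjacency matrix: (a , b) ∈ E  iff  E a b ≡ true.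
Graph : ℕ → ℕ → Set
Graph n m = Fin n → Fin m → Bool

Γ : ∀ {n m} → Graph n m → Subset n → Subset m
Γ {n} E X = tabulate (λ b → any (λ a → lookup X a ∧ E a b) (allFin n))

-- A semi-matching: every a ∈ A has exactly one S-edge, i.e. a function
-- S : A → B whose edges (a , S a) lie in E.
IsSemiMatching : ∀ {n m} → Graph n m → (Fin n → Fin m) → Set
IsSemiMatching E S = ∀ a → E a (S a) ≡ true

deg : ∀ {n m} → (Fin n → Fin m) → Fin m → ℕ
deg S b = ∣ tabulate (λ a → ⌊ S a ≟ b ⌋) ∣

degMax : ∀ {n m} → (Fin n → Fin m) → ℕ
degMax {m = m} S = foldr _⊔_ 0 (map (deg S) (allFin m))

-- A degree-minimizing path w.r.t. S: a (simple) path
--   b_1, a_1, b_2, ..., a_{k-1}, b_k   (here L = k - 1)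
-- with (a_i , b_i) ∈ S, (a_i , b_{i+1}) ∈ E ∖ S, and deg_S(b_1) ≥ deg_S(b_k) + 2.
record DegMinPath {n m} (E : Graph n m) (S : Fin n → Fin m) : Set where
  field
    L      : ℕ
    as     : Fin L → Fin n
    bs     : Fin (suc L) → Fin m
    as-inj : Injective _≡_ _≡_ as
    bs-inj : Injective _≡_ _≡_ bs
    inS    : ∀ i → S (as i) ≡ bs (inject₁ i)
    inE    : ∀ i → E (as i) (bs (suc i)) ≡ true
    notS   : ∀ i → S (as i) ≢ bs (suc i)
    degGap : deg S (bs (fromℕ L)) + 2 ≤ deg S (bs zero)

IsOptimalSemiMatching : ∀ {n m} → Graph n m → (Fin n → Fin m) → Set
IsOptimalSemiMatching E S = IsSemiMatching E S × ¬ DegMinPath E S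

-- A' attains min over nonempty A'' ⊆ A of |Γ(A'')| / |A''|
-- (cross-multiplied, all denominators being positive).
MinExpansion : ∀ {n m} → Graph n m → Subset n → Set
MinExpansion {n} E A′ =
  Nonempty A′ ×
  (∀ (A″ : Subset n) → Nonempty A″ → ∣ Γ E A′ ∣ * ∣ A″ ∣ ≤ ∣ Γ E A″ ∣ * ∣ A′ ∣)

-- ⌈ p / q ⌉ for q > 0 (value 0 when q = 0, never used).
ceilDiv : ℕ → ℕ → ℕ
ceilDiv p zero = 0
ceilDiv p (suc k) = (p + k) / suc k

module Submission where

-- Let b* have maximal degree d + 1 in the optimal semi-matching S. Every vertex b reachable
-- from b* by an alternating path has degree at least d, for otherwise that path would be
-- degree-minimizing. The set R of these vertices is closed under alternating steps, so
-- X = S⁻¹(R) satisfies Γ(X) ⊆ R and |X| > d |R| ≥ d |Γ(X)|; by minimality of A′ this gives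
-- d < 1/α. Conversely A′ is matched into Γ(A′), so |A′| ≤ (d + 1) |Γ(A′)|, i.e. 1/α ≤ d + 1.

open import Defs
open import Data.Nat using (ℕ; zero; suc; _+_; _*_; _≤_; _<_; _⊔_; _≤?_; z≤n; s≤s)
open import Data.Nat.Properties
  using (module ≤-Reasoning; ≤-refl; ≤-reflexive; ≤-trans; ≤-<-trans; ≤-antisym; ≤-pred;
         <⇒≱; ≰⇒>; >⇒≢; +-comm; +-suc; +-mono-≤; +-monoʳ-≤; +-mono-≤-<; +-mono-<-≤;
         *-comm; *-assoc; *-zeroʳ; *-monoˡ-≤; *-monoʳ-<; *-cancelˡ-<; m≤m+n; m≤m⊔n; m≤n⊔m; ⊔-sel;
         +-commutativeSemigroup)
open import Algebra.Properties.CommutativeSemigroup +-commutativeSemigroup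
  using () renaming (interchange to +-interchange)
open import Data.Nat.DivMod using (_/_; m*n/n≡m; /-monoˡ-≤; m<n*o⇒m/o<n)
open import Data.Bool using (Bool; true; false; T; _∧_)
open import Data.Bool.Properties using (T-≡; T-∧) renaming (_≟_ to _≟ᵇ_)
open import Data.Fin using (Fin; zero; suc; inject₁; fromℕ; _≟_)
open import Data.Fin.Properties using (any?; inject₁-injective; suc-injective)
open import Data.Fin.Subset using (Subset; ∣_∣; Nonempty; _∈_; _∉_; _⊆_; _∪_; ⁅_⁆; inside; outside)
open import Data.Fin.Subset.Properties
  using (_∈?_; nonempty?; Empty-unique; ∣⊥∣≡0; p⊆q⇒∣p∣≤∣q∣; p⊂q⇒∣p∣<∣q∣; ∣p∣≤n; ∣⁅x⁆∣≡1;
         x∈⁅x⁆; x∈⁅y⁆⇒x≡y; p⊆p∪q; q⊆p∪q; x∈p∪q⁻)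
open import Data.Vec using ([]; _∷_; tabulate; lookup; here; there)
open import Data.Vec.Properties using (lookup∘tabulate; []=⇒lookup; lookup⇒[]=)
open import Data.List using (allFin; map)
open import Data.List.Relation.Unary.All as All using ()
open import Data.List.Relation.Unary.Any using (satisfied)
open import Data.List.Relation.Unary.Any.Properties using (any⁺; any⁻; tabulate⁺)
open import Data.List.Membership.Propositional.Properties using (∈-map⁺; ∈-map⁻; ∈-allFin; foldr-selective)
open import Data.List.Properties using (foldr-forcesᵇ)
open import Data.Bool.ListAction using (any)
open import Data.Product using (Σ; ∃; _×_; _,_; proj₂)
open import Data.Sum using (inj₁; inj₂)
open import Function using (_∘_; const; Equivalence)
open import Function.Definitions using (Injective)
open import Level using (0ℓ)
open import Relation.Binary using (Rel; Decidable)
open import Relation.Binary.PropositionalEquality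
open import Relation.Nullary using (¬_; Dec; yes; no; contradiction)
open import Relation.Nullary.Decidable using (⌊_⌋; ⌊⌋-map′; _×-dec_; ¬?; decidable-stable)
open import Relation.Unary using (Pred)

private
  variable
    n m : ℕ

𝟙 : Bool → ℕ
𝟙 true  = 1
𝟙 false = 0

∣x∷p∣ : ∀ x (p : Subset n) → ∣ x ∷ p ∣ ≡ 𝟙 x + ∣ p ∣
∣x∷p∣ true  p = refl
∣x∷p∣ false p = refl

∈⇒0<∣p∣ : ∀ {x} {p : Subset n} → x ∈ p → 0 < ∣ p ∣
∈⇒0<∣p∣ {x = x} {p} x∈p = subst (_≤ ∣ p ∣) (∣⁅x⁆∣≡1 x) (p⊆q⇒∣p∣≤∣q∣ ⁅x⁆⊆p)
  where
  ⁅x⁆⊆p : ⁅ x ⁆ ⊆ p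
  ⁅x⁆⊆p y∈⁅x⁆ = subst (_∈ p) (sym (x∈⁅y⁆⇒x≡y x y∈⁅x⁆)) x∈p

0<∣p∣⇒Nonempty : ∀ {p : Subset n} → 0 < ∣ p ∣ → Nonempty p
0<∣p∣⇒Nonempty {n} {p} 0<∣p∣ with nonempty? p
... | yes ne = ne
... | no empty = contradiction (trans (cong ∣_∣ (Empty-unique empty)) (∣⊥∣≡0 n)) (>⇒≢ 0<∣p∣)

sumOver : Subset n → (Fin n → ℕ) → ℕ
sumOver []            f = 0
sumOver (inside  ∷ p) f = f zero + sumOver p (f ∘ suc)
sumOver (outside ∷ p) f = sumOver p (f ∘ suc)

sumOver-cong : ∀ (p : Subset n) {f g} → (∀ x → f x ≡ g x) → sumOver p f ≡ sumOver p g
sumOver-cong []            f≗g = refl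
sumOver-cong (inside  ∷ p) f≗g = cong₂ _+_ (f≗g zero) (sumOver-cong p (f≗g ∘ suc))
sumOver-cong (outside ∷ p) f≗g = sumOver-cong p (f≗g ∘ suc)

sumOver-const : ∀ (p : Subset n) d → sumOver p (const d) ≡ ∣ p ∣ * d
sumOver-const []            d = refl
sumOver-const (inside  ∷ p) d = cong (d +_) (sumOver-const p d)
sumOver-const (outside ∷ p) d = sumOver-const p d

sumOver-zero : ∀ (p : Subset n) → sumOver p (const 0) ≡ 0
sumOver-zero p = trans (sumOver-const p 0) (*-zeroʳ ∣ p ∣)

sumOver-+ : ∀ (p : Subset n) f g → sumOver p (λ x → f x + g x) ≡ sumOver p f + sumOver p g
sumOver-+ []            f g = refl
sumOver-+ (inside  ∷ p) f g = begin
  f zero + g zero + sumOver p (λ x → f (suc x) + g (suc x))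
    ≡⟨ cong (f zero + g zero +_) (sumOver-+ p (f ∘ suc) (g ∘ suc)) ⟩
  f zero + g zero + (sumOver p (f ∘ suc) + sumOver p (g ∘ suc))
    ≡⟨ +-interchange (f zero) (g zero) _ _ ⟩
  f zero + sumOver p (f ∘ suc) + (g zero + sumOver p (g ∘ suc)) ∎
  where open ≡-Reasoning
sumOver-+ (outside ∷ p) f g = sumOver-+ p (f ∘ suc) (g ∘ suc)

sumOver-𝟙≟ : ∀ (p : Subset n) c → sumOver p (λ x → 𝟙 ⌊ c ≟ x ⌋) ≡ 𝟙 (lookup p c)

sumOver-𝟙≟-suc : ∀ (p : Subset n) c →
                 sumOver p (λ x → 𝟙 ⌊ suc c ≟ suc x ⌋) ≡ 𝟙 (lookup p c)
sumOver-𝟙≟-suc p c =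
  trans (sumOver-cong p (λ x → cong 𝟙 (⌊⌋-map′ _ _ (c ≟ x)))) (sumOver-𝟙≟ p c)

sumOver-𝟙≟ (inside  ∷ p) zero    = cong suc (sumOver-zero p)
sumOver-𝟙≟ (outside ∷ p) zero    = sumOver-zero p
sumOver-𝟙≟ (inside  ∷ p) (suc c) = sumOver-𝟙≟-suc p c
sumOver-𝟙≟ (outside ∷ p) (suc c) = sumOver-𝟙≟-suc p c

sumOver-mono-≤ : ∀ (p : Subset n) {f g} → (∀ {x} → x ∈ p → f x ≤ g x) → sumOver p f ≤ sumOver p g
sumOver-mono-≤ []            f≤g = z≤n
sumOver-mono-≤ (inside  ∷ p) f≤g = +-mono-≤ (f≤g here) (sumOver-mono-≤ p (f≤g ∘ there))
sumOver-mono-≤ (outside ∷ p) f≤g = sumOver-mono-≤ p (f≤g ∘ there)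

sumOver-mono-< : ∀ (p : Subset n) {f g} → (∀ {x} → x ∈ p → f x ≤ g x) →
                 ∀ {x} → x ∈ p → f x < g x → sumOver p f < sumOver p g
sumOver-mono-< (inside  ∷ p) f≤g here        fx<gx = +-mono-<-≤ fx<gx (sumOver-mono-≤ p (f≤g ∘ there))
sumOver-mono-< (inside  ∷ p) f≤g (there x∈p) fx<gx =
  +-mono-≤-< (f≤g here) (sumOver-mono-< p (f≤g ∘ there) x∈p fx<gx)
sumOver-mono-< (outside ∷ p) f≤g (there x∈p) fx<gx = sumOver-mono-< p (f≤g ∘ there) x∈p fx<gx

preimage : (Fin n → Fin m) → Subset m → Subset n
preimage S p = tabulate (λ a → lookup p (S a))

∈-preimage⁺ : ∀ (S : Fin n → Fin m) {p a} → S a ∈ p → a ∈ preimage S p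
∈-preimage⁺ S {a = a} Sa∈p =
  lookup⇒[]= a _ (trans (lookup∘tabulate _ a) ([]=⇒lookup Sa∈p))

∈-preimage⁻ : ∀ (S : Fin n → Fin m) {p a} → a ∈ preimage S p → S a ∈ p
∈-preimage⁻ S {p} {a} a∈S⁻¹p =
  lookup⇒[]= (S a) p (trans (sym (lookup∘tabulate _ a)) ([]=⇒lookup a∈S⁻¹p))

deg-suc : ∀ (S : Fin (suc n) → Fin m) b → deg S b ≡ 𝟙 ⌊ S zero ≟ b ⌋ + deg (S ∘ suc) b
deg-suc S b = ∣x∷p∣ ⌊ S zero ≟ b ⌋ (tabulate (λ a → ⌊ S (suc a) ≟ b ⌋))

∣preimage∣≡sumOver-deg : ∀ (S : Fin n → Fin m) p → ∣ preimage S p ∣ ≡ sumOver p (deg S)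
∣preimage∣≡sumOver-deg {zero}  S p = sym (sumOver-zero p)
∣preimage∣≡sumOver-deg {suc n} S p = begin
  ∣ lookup p (S zero) ∷ preimage (S ∘ suc) p ∣
    ≡⟨ ∣x∷p∣ (lookup p (S zero)) (preimage (S ∘ suc) p) ⟩
  𝟙 (lookup p (S zero)) + ∣ preimage (S ∘ suc) p ∣
    ≡⟨ cong₂ _+_ (sym (sumOver-𝟙≟ p (S zero))) (∣preimage∣≡sumOver-deg (S ∘ suc) p) ⟩
  sumOver p (λ b → 𝟙 ⌊ S zero ≟ b ⌋) + sumOver p (deg (S ∘ suc))
    ≡⟨ sym (sumOver-+ p _ _) ⟩
  sumOver p (λ b → 𝟙 ⌊ S zero ≟ b ⌋ + deg (S ∘ suc) b)
    ≡⟨ sumOver-cong p (λ b → sym (deg-suc S b)) ⟩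
  sumOver p (deg S) ∎
  where open ≡-Reasoning

deg≤degMax : ∀ (S : Fin n → Fin m) b → deg S b ≤ degMax S
deg≤degMax S b =
  All.lookup (foldr-forcesᵇ ⊔-bounded 0 _ ≤-refl) (∈-map⁺ (deg S) (∈-allFin b))
  where
  ⊔-bounded : ∀ x y → x ⊔ y ≤ degMax S → x ≤ degMax S × y ≤ degMax S
  ⊔-bounded x y x⊔y≤ = ≤-trans (m≤m⊔n x y) x⊔y≤ , ≤-trans (m≤n⊔m x y) x⊔y≤

degMax-attained : ∀ (S : Fin n → Fin m) {d} → degMax S ≡ suc d → ∃ λ b → deg S b ≡ suc d
degMax-attained {m = m} S degMax≡ with foldr-selective ⊔-sel 0 (map (deg S) (allFin m))
... | inj₁ degMax≡0 = contradiction (trans (sym degMax≡) degMax≡0) λ ()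
... | inj₂ degMax∈ with ∈-map⁻ (deg S) degMax∈
...   | b , _ , degMax≡deg = b , trans (sym degMax≡deg) degMax≡

lookup-Γ : ∀ (E : Graph n m) X b → lookup (Γ E X) b ≡ any (λ a → lookup X a ∧ E a b) (allFin n)
lookup-Γ E X b = lookup∘tabulate _ b

∈-Γ⁺ : ∀ (E : Graph n m) {X a b} → a ∈ X → E a b ≡ true → b ∈ Γ E X
∈-Γ⁺ E {X} {a} {b} a∈X Eab =
  lookup⇒[]= b (Γ E X) (trans (lookup-Γ E X b) (Equivalence.to T-≡ (any⁺ _ (tabulate⁺ a a∧))))
  where
  a∧ : T (lookup X a ∧ E a b)
  a∧ = Equivalence.from T-∧ (Equivalence.from T-≡ ([]=⇒lookup a∈X) , Equivalence.from T-≡ Eab)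

∈-Γ⁻ : ∀ (E : Graph n m) {X b} → b ∈ Γ E X → ∃ λ a → a ∈ X × E a b ≡ true
∈-Γ⁻ {n} E {X} {b} b∈ΓX
  with a , a∧ ← satisfied (any⁻ _ (allFin n)
                  (Equivalence.from T-≡ (trans (sym (lookup-Γ E X b)) ([]=⇒lookup b∈ΓX))))
  with a∈X , Eab ← Equivalence.to T-∧ a∧
  = a , lookup⇒[]= a X (Equivalence.to T-≡ a∈X) , Equivalence.to T-≡ Eab

∣X∣≤degMax*∣ΓX∣ : ∀ (E : Graph n m) S → IsSemiMatching E S → ∀ X →
                  ∣ X ∣ ≤ degMax S * ∣ Γ E X ∣
∣X∣≤degMax*∣ΓX∣ E S semi X = begin
  ∣ X ∣                                ≤⟨ p⊆q⇒∣p∣≤∣q∣ X⊆S⁻¹ΓX ⟩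
  ∣ preimage S (Γ E X) ∣               ≡⟨ ∣preimage∣≡sumOver-deg S (Γ E X) ⟩
  sumOver (Γ E X) (deg S)              ≤⟨ sumOver-mono-≤ (Γ E X) (λ {b} _ → deg≤degMax S b) ⟩
  sumOver (Γ E X) (const (degMax S))   ≡⟨ sumOver-const (Γ E X) (degMax S) ⟩
  ∣ Γ E X ∣ * degMax S                 ≡⟨ *-comm ∣ Γ E X ∣ (degMax S) ⟩
  degMax S * ∣ Γ E X ∣                 ∎
  where
  open ≤-Reasoning
  X⊆S⁻¹ΓX : X ⊆ preimage S (Γ E X)
  X⊆S⁻¹ΓX a∈X = ∈-preimage⁺ S (∈-Γ⁺ E a∈X (semi _))

snoc : ∀ {A : Set} {L} → (Fin L → A) → A → Fin (suc L) → A
snoc {L = zero}  f x _       = x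
snoc {L = suc L} f x zero    = f zero
snoc {L = suc L} f x (suc i) = snoc (f ∘ suc) x i

snoc-last : ∀ {A : Set} {L} (f : Fin L → A) x → snoc f x (fromℕ L) ≡ x
snoc-last {L = zero}  f x = refl
snoc-last {L = suc L} f x = snoc-last (f ∘ suc) x

snoc-inject₁ : ∀ {A : Set} {L} (f : Fin L → A) x i → snoc f x (inject₁ i) ≡ f i
snoc-inject₁ f x zero    = refl
snoc-inject₁ f x (suc i) = snoc-inject₁ (f ∘ suc) x i

data SnocView : ∀ {L} → Fin (suc L) → Set where
  last : ∀ {L} → SnocView (fromℕ L)
  init : ∀ {L} (j : Fin L) → SnocView (inject₁ j)

snocView : ∀ {L} (i : Fin (suc L)) → SnocView i
snocView {zero}  zero    = last
snocView {suc L} zero    = init zero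
snocView {suc L} (suc i) with snocView i
... | last   = last
... | init j = init (suc j)

snoc-injective : ∀ {A : Set} {L} {f : Fin L → A} {x} → Injective _≡_ _≡_ f → (∀ j → f j ≢ x) →
                 Injective _≡_ _≡_ (snoc f x)
snoc-injective {f = f} {x} f-inj fresh {i} {j} eq with snocView i | snocView j
... | last    | last    = refl
... | last    | init j′ rewrite snoc-last f x | snoc-inject₁ f x j′ = contradiction (sym eq) (fresh j′)
... | init i′ | last    rewrite snoc-last f x | snoc-inject₁ f x i′ = contradiction eq (fresh i′)
... | init i′ | init j′ rewrite snoc-inject₁ f x i′ | snoc-inject₁ f x j′ = cong inject₁ (f-inj eq)

inject₁≢suc : ∀ {L} (i : Fin L) → inject₁ i ≢ suc i
inject₁≢suc zero    ()
inject₁≢suc (suc i) eq = inject₁≢suc i (suc-injective eq)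

Closed : ∀ {ℓ} → Rel (Fin m) ℓ → Subset m → Set ℓ
Closed _⟶_ R = ∀ {c b} → c ∈ R → c ⟶ b → b ∈ R

saturate : ∀ {ℓ p} {_⟶_ : Rel (Fin m) ℓ} → Decidable _⟶_ → (P : Pred (Subset m) p) →
           (∀ {R c b} → P R → c ∈ R → c ⟶ b → b ∉ R → P (R ∪ ⁅ b ⁆)) →
           ∀ {R} → P R → Σ (Subset m) λ R′ → P R′ × Closed _⟶_ R′
saturate {m} {_⟶_ = _⟶_} _⟶?_ P grow {R} PR = go m R (m≤m+n m ∣ R ∣) PR
  where
  exit? : ∀ R → Dec (∃ λ c → ∃ λ b → c ∈ R × c ⟶ b × b ∉ R)
  exit? R = any? λ c → any? λ b → (c ∈? R) ×-dec (c ⟶? b) ×-dec ¬? (b ∈? R)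

  ∣R∣<∣R∪⁅b⁆∣ : ∀ {R b} → b ∉ R → ∣ R ∣ < ∣ R ∪ ⁅ b ⁆ ∣
  ∣R∣<∣R∪⁅b⁆∣ {R} {b} b∉R = p⊂q⇒∣p∣<∣q∣ (p⊆p∪q ⁅ b ⁆ , b , q⊆p∪q R ⁅ b ⁆ (x∈⁅x⁆ b) , b∉R)

  go : ∀ k R → m ≤ k + ∣ R ∣ → P R → Σ (Subset m) λ R′ → P R′ × Closed _⟶_ R′
  go k R room PR with exit? R
  ... | no stuck = R , PR , λ {c} {b} c∈R c⟶b →
        decidable-stable (b ∈? R) (λ b∉R → stuck (c , b , c∈R , c⟶b , b∉R))
  go zero    R room PR | yes (_ , b , _ , _ , b∉R) =
    contradiction room (<⇒≱ (≤-trans (∣R∣<∣R∪⁅b⁆∣ b∉R) (∣p∣≤n (R ∪ ⁅ b ⁆))))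
  go (suc k) R room PR | yes (c , b , c∈R , c⟶b , b∉R) =
    go k (R ∪ ⁅ b ⁆) room′ (grow PR c∈R c⟶b b∉R)
    where
    open ≤-Reasoning
    room′ : m ≤ k + ∣ R ∪ ⁅ b ⁆ ∣
    room′ = begin
      m                 ≤⟨ room ⟩
      suc k + ∣ R ∣     ≡⟨ sym (+-suc k ∣ R ∣) ⟩
      k + suc ∣ R ∣     ≤⟨ +-monoʳ-≤ k (∣R∣<∣R∪⁅b⁆∣ b∉R) ⟩
      k + ∣ R ∪ ⁅ b ⁆ ∣ ∎

module _ (E : Graph n m) (S : Fin n → Fin m) where

  AltStep : Rel (Fin m) 0ℓ
  AltStep c b = ∃ λ a → S a ≡ c × E a b ≡ true

  altStep? : Decidable AltStep
  altStep? c b = any? λ a → (S a ≟ c) ×-dec (E a b ≟ᵇ true)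

  -- Injectivity of as and the field notS of a DegMinPath follow from bs-inj and inS.
  record AltPath (R : Subset m) (b₀ b : Fin m) : Set where
    field
      L      : ℕ
      as     : Fin L → Fin n
      bs     : Fin (suc L) → Fin m
      bs-inj : Injective _≡_ _≡_ bs
      inS    : ∀ i → S (as i) ≡ bs (inject₁ i)
      inE    : ∀ i → E (as i) (bs (suc i)) ≡ true
      start  : bs zero ≡ b₀
      end    : bs (fromℕ L) ≡ b
      within : ∀ i → bs i ∈ R

  toDegMinPath : ∀ {R b₀ b} → AltPath R b₀ b → deg S b + 2 ≤ deg S b₀ → DegMinPath E S
  toDegMinPath P gap = record
    { L      = L
    ; as     = as
    ; bs     = bs
    ; as-inj = λ {i} {j} asᵢ≡asⱼ →
        inject₁-injective (bs-inj (trans (sym (inS i)) (trans (cong S asᵢ≡asⱼ) (inS j))))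
    ; bs-inj = bs-inj
    ; inS    = inS
    ; inE    = inE
    ; notS   = λ i Sasᵢ≡ → inject₁≢suc i (bs-inj (trans (sym (inS i)) Sasᵢ≡))
    ; degGap = subst₂ (λ x y → deg S x + 2 ≤ deg S y) (sym end) (sym start) gap
    }
    where open AltPath P

  trivialPath : ∀ b₀ → AltPath ⁅ b₀ ⁆ b₀ b₀
  trivialPath b₀ = record
    { L = 0 ; as = λ () ; bs = const b₀ ; bs-inj = λ { {zero} {zero} _ → refl }
    ; inS = λ () ; inE = λ () ; start = refl ; end = refl ; within = λ _ → x∈⁅x⁆ b₀ }

  widen : ∀ {R R′ b₀ b} → R ⊆ R′ → AltPath R b₀ b → AltPath R′ b₀ b
  widen R⊆R′ P = record
    { L = L ; as = as ; bs = bs ; bs-inj = bs-inj ; inS = inS ; inE = inE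
    ; start = start ; end = end ; within = R⊆R′ ∘ within }
    where open AltPath P

  extend : ∀ {R b₀ c a b} → AltPath R b₀ c → S a ≡ c → E a b ≡ true → b ∉ R →
           AltPath (R ∪ ⁅ b ⁆) b₀ b
  extend {R} {a = a} {b} P Sa≡c Eab b∉R = record
    { L      = suc L
    ; as     = snoc as a
    ; bs     = snoc bs b
    ; bs-inj = snoc-injective bs-inj (λ j bsⱼ≡b → b∉R (subst (_∈ R) bsⱼ≡b (within j)))
    ; inS    = inS′
    ; inE    = inE′
    ; start  = start
    ; end    = snoc-last bs b
    ; within = within′
    }
    where
    open AltPath P
    inS′ : ∀ i → S (snoc as a i) ≡ snoc bs b (inject₁ i)
    inS′ i with snocView i
    ... | last   rewrite snoc-last as a     | snoc-inject₁ bs b (fromℕ L)   = trans Sa≡c (sym end)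
    ... | init j rewrite snoc-inject₁ as a j | snoc-inject₁ bs b (inject₁ j) = inS j
    inE′ : ∀ i → E (snoc as a i) (snoc bs b (suc i)) ≡ true
    inE′ i with snocView i
    ... | last   rewrite snoc-last as a     | snoc-last bs b            = Eab
    ... | init j rewrite snoc-inject₁ as a j | snoc-inject₁ bs b (suc j) = inE j
    within′ : ∀ i → snoc bs b i ∈ R ∪ ⁅ b ⁆
    within′ i with snocView i
    ... | last   rewrite snoc-last bs b      = q⊆p∪q R ⁅ b ⁆ (x∈⁅x⁆ b)
    ... | init j rewrite snoc-inject₁ bs b j = p⊆p∪q ⁅ b ⁆ (within j)

  Explored : Fin m → Subset m → Set
  Explored b₀ R = b₀ ∈ R × (∀ {b} → b ∈ R → AltPath R b₀ b)

  explored-⁅⁆ : ∀ b₀ → Explored b₀ ⁅ b₀ ⁆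
  explored-⁅⁆ b₀ = x∈⁅x⁆ b₀ , λ b∈⁅b₀⁆ →
    subst (AltPath ⁅ b₀ ⁆ b₀) (sym (x∈⁅y⁆⇒x≡y b₀ b∈⁅b₀⁆)) (trivialPath b₀)

  explore : ∀ {b₀ R c b} → Explored b₀ R → c ∈ R → AltStep c b → b ∉ R → Explored b₀ (R ∪ ⁅ b ⁆)
  explore {b₀} {R} {b = b} (b₀∈R , path) c∈R (a , Sa≡c , Eab) b∉R = p⊆p∪q ⁅ b ⁆ b₀∈R , path′
    where
    path′ : ∀ {b′} → b′ ∈ R ∪ ⁅ b ⁆ → AltPath (R ∪ ⁅ b ⁆) b₀ b′
    path′ b′∈ with x∈p∪q⁻ R ⁅ b ⁆ b′∈
    ... | inj₁ b′∈R    = widen (p⊆p∪q ⁅ b ⁆) (path b′∈R)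
    ... | inj₂ b′∈⁅b⁆ rewrite x∈⁅y⁆⇒x≡y b b′∈⁅b⁆ = extend (path c∈R) Sa≡c Eab b∉R

  sparse-preimage : ¬ DegMinPath E S → ∀ {b* d R} → deg S b* ≡ suc d →
                    Explored b* R → Closed AltStep R →
                    ∣ Γ E (preimage S R) ∣ * d < ∣ preimage S R ∣
  sparse-preimage optimal {b*} {d} {R} deg-b* (b*∈R , path) closed = begin-strict
    ∣ Γ E X ∣ * d       ≤⟨ *-monoˡ-≤ d (p⊆q⇒∣p∣≤∣q∣ ΓX⊆R) ⟩
    ∣ R ∣ * d           ≡⟨ sym (sumOver-const R d) ⟩
    sumOver R (const d) <⟨ sumOver-mono-< R d≤deg b*∈R (≤-reflexive (sym deg-b*)) ⟩
    sumOver R (deg S)   ≡⟨ sym (∣preimage∣≡sumOver-deg S R) ⟩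
    ∣ X ∣               ∎
    where
    open ≤-Reasoning
    X = preimage S R

    ΓX⊆R : Γ E X ⊆ R
    ΓX⊆R b∈ΓX with a , a∈X , Eab ← ∈-Γ⁻ E b∈ΓX = closed (∈-preimage⁻ S a∈X) (a , refl , Eab)

    d≤deg : ∀ {b} → b ∈ R → d ≤ deg S b
    d≤deg {b} b∈R with d ≤? deg S b
    ... | yes d≤deg = d≤deg
    ... | no  d≰deg = contradiction (toDegMinPath (path b∈R) gap) optimal
      where
      gap : deg S b + 2 ≤ deg S b*
      gap = begin
        deg S b + 2          ≡⟨ +-comm (deg S b) 2 ⟩
        suc (suc (deg S b))  ≤⟨ s≤s (≰⇒> d≰deg) ⟩
        suc d                ≡⟨ sym deg-b* ⟩
        deg S b*             ∎

  sparse-set : ¬ DegMinPath E S → ∀ {b* d} → deg S b* ≡ suc d →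
               Σ (Subset n) λ X → Nonempty X × ∣ Γ E X ∣ * d < ∣ X ∣
  sparse-set optimal {b*} deg-b*
    with R , explored , closed ← saturate altStep? (Explored b*) explore (explored-⁅⁆ b*)
    = preimage S R , 0<∣p∣⇒Nonempty (≤-<-trans z≤n ∣ΓX∣*d<∣X∣) , ∣ΓX∣*d<∣X∣
    where ∣ΓX∣*d<∣X∣ = sparse-preimage optimal deg-b* explored closed

*-cross-< : ∀ {d p q r x} → 0 < q → r * d < x → q * x ≤ r * p → d * q < p
*-cross-< {d} {p} {suc q′} {r} {x} _ rd<x qx≤rp = *-cancelˡ-< r (d * q) p (begin-strict
  r * (d * q) ≡⟨ sym (*-assoc r d q) ⟩
  r * d * q   ≡⟨ *-comm (r * d) q ⟩
  q * (r * d) <⟨ *-monoʳ-< q rd<x ⟩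
  q * x       ≤⟨ qx≤rp ⟩
  r * p       ∎)
  where
  open ≤-Reasoning
  q = suc q′

ceilDiv-unique : ∀ {p q d} → p ≤ suc d * q → d * q < p → ceilDiv p q ≡ suc d
ceilDiv-unique {q = zero}            p≤ d*0<p = contradiction p≤ (<⇒≱ d*0<p)
ceilDiv-unique {p} {suc k} {d} p≤ d*q<p = ≤-antisym (≤-pred (m<n*o⇒m/o<n p+k<)) (begin
  suc d                   ≡⟨ sym (m*n/n≡m (suc d) q) ⟩
  suc d * q / q           ≤⟨ /-monoˡ-≤ q (begin
      suc d * q           ≡⟨ sym (+-suc k (d * q)) ⟩
      k + suc (d * q)     ≤⟨ +-monoʳ-≤ k d*q<p ⟩
      k + p               ≡⟨ +-comm k p ⟩
      p + k               ∎) ⟩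
  (p + k) / q             ∎)
  where
  open ≤-Reasoning
  q = suc k
  p+k< : p + k < suc (suc d) * q
  p+k< = begin-strict
    p + k         <⟨ +-mono-≤-< p≤ ≤-refl ⟩
    suc d * q + q ≡⟨ +-comm (suc d * q) q ⟩
    q + suc d * q ∎

lemma4 : ∀ (n m : ℕ) (E : Graph n m) →
    (∀ (a : Fin n) → ∃ λ (b : Fin m) → E a b ≡ true) →
    ∀ (S : Fin n → Fin m) → IsOptimalSemiMatching E S →
    ∀ (A′ : Subset n) → MinExpansion E A′ →
    degMax S ≡ ceilDiv ∣ A′ ∣ ∣ Γ E A′ ∣
lemma4 n m E has-neighbour S (semi , optimal) A′ ((a₀ , a₀∈A′) , minimal)
  with degMax S in degMax≡ | ∣X∣≤degMax*∣ΓX∣ E S semi A′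
... | zero  | ∣A′∣≤0 = contradiction ∣A′∣≤0 (<⇒≱ (∈⇒0<∣p∣ a₀∈A′))
... | suc d | ∣A′∣≤
  with b* , deg-b* ← degMax-attained S degMax≡
  with X , X≠∅ , ∣ΓX∣*d<∣X∣ ← sparse-set E S optimal deg-b*
  = sym (ceilDiv-unique ∣A′∣≤ (*-cross-< {r = ∣ Γ E X ∣} 0<∣ΓA′∣ ∣ΓX∣*d<∣X∣ (minimal X X≠∅)))
  where
  0<∣ΓA′∣ : 0 < ∣ Γ E A′ ∣
  0<∣ΓA′∣ = ∈⇒0<∣p∣ (∈-Γ⁺ E a₀∈A′ (proj₂ (has-neighbour a₀)))
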